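{- Let $p$ and $q$ be odd primes with $p\mid q-1$, let $r\in\mathbb F_q^\times$ have multiplicative order $p$, and let $A\subseteq\mathbb F_q$ be a union of sets of the form $\{0\}$ and $g\{1,r,r^2,\dots,r^{p-1}\}$ with $g\in\mathbb F_q\setminus\{0\}$. If $2\leq |A|\leq q-2$, then $A$ is not an arithmetic progression, i.e., there do not exist $a\in\mathbb F_q$ and $d\in\mathbb F_q^\times$ with $A=\{a,a+d,\dots,a+(|A|-1)d\}$. -}

module Defs where

open import Data.Nat using (ℕ; zero; suc; _+_; _*_; _<_; NonZero)
open import Data.Nat.DivMod using (_%_; m%n<n)
open import Data.Fin using (Fin; toℕ; fromℕ<)
open import Data.Fin.Subset using (Subset; _∈_; ∣_∣)
open import Data.Product using (Σ; ∃; _×_)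
open import Data.Sum using (_⊎_)
open import Relation.Binary.PropositionalEquality using (_≡_; _≢_)
open import Relation.Nullary using (¬_)
open import Function.Bundles using (_⇔_)

-- The prime field F_q, q prime, modelled as Fin q = {0,…,q-1} with arithmetic mod q.
module _ {q : ℕ} .{{_ : NonZero q}} where

  ι : ℕ → Fin q
  ι n = fromℕ< (m%n<n n q)

  𝟘 𝟙 : Fin q
  𝟘 = ι 0
  𝟙 = ι 1

  infixl 6 _⊕_
  infixl 7 _⊗_
  _⊕_ : Fin q → Fin q → Fin q
  x ⊕ y = ι (toℕ x + toℕ y)

  _⊗_ : Fin q → Fin q → Fin q
  x ⊗ y = ι (toℕ x * toℕ y)

  _^ᶠ_ : Fin q → ℕ → Fin q
  x ^ᶠ zero  = 𝟙
  x ^ᶠ suc k = x ⊗ (x ^ᶠ k)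

  HasOrder : Fin q → ℕ → Set
  HasOrder r p = r ≢ 𝟘 × 0 < p × r ^ᶠ p ≡ 𝟙
                 × (∀ k → 0 < k → k < p → r ^ᶠ k ≢ 𝟙)

  InCoset : ℕ → Fin q → Fin q → Fin q → Set
  InCoset p r g x = ∃ λ i → i < p × x ≡ g ⊗ (r ^ᶠ i)

  UnionOfOrbits : ℕ → Fin q → Subset q → Set
  UnionOfOrbits p r A =
    ∀ x → x ∈ A →
      (x ≡ 𝟘) ⊎ (∃ λ g → g ≢ 𝟘 × InCoset p r g x
                         × (∀ y → InCoset p r g y → y ∈ A))

  IsAP : Subset q → Set
  IsAP A = ∃ λ a → ∃ λ d → d ≢ 𝟘 ×
             (∀ x → (x ∈ A) ⇔ (∃ λ i → i < ∣ A ∣ × x ≡ a ⊕ ι i ⊗ d))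

{-# OPTIONS --safe #-}
module Submission where

-- Write t for the integer representative of r. Since r has odd order p > 2, r ≠ 0 and
-- r² ≠ 1, so 2 ≤ t ≤ q − 2. A is a union of r-orbits, hence rA = A. If A is the
-- progression a, a + d, …, a + (m − 1)d, then every y ∈ A is r·(a + jd) for some
-- term a + jd, and unless that term is the last one, y + rd = r·(a + (j + 1)d) ∈ A.
-- Now pick two consecutive terms a + id, a + (i + 1)d of A whose shifts by rd = td,
-- namely a + (t + i)d and a + (t + i + 1)d, have indices in [m, q). As q is prime,
-- the terms a + kd with k < q are pairwise distinct, so neither shift lies in A;
-- hence both terms are r times the last term, which is absurd.

open import Defs
open import Data.Nat using (ℕ; zero; suc; pred; _+_; _*_; _≤_; _<_; _∸_; NonZero; z≤n; s≤s; _<?_; >-nonZero)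
open import Data.Nat.Base using (nonTrivial⇒n>1)
open import Data.Nat.Properties
open import Data.Nat.DivMod
  using (_%_; _/_; m≡m%n+[m/n]*n; m<n⇒m%n≡m; %-distribˡ-+; %-distribˡ-*; [m+n]%n≡m%n; [m+kn]%n≡m%n)
open import Data.Nat.Divisibility using (_∣_; divides; >⇒∤)
open import Data.Nat.Primality using (Prime; euclidsLemma; prime⇒nonTrivial)
open import Data.Nat.Tactic.RingSolver using (solve-∀)
open import Data.Fin using (Fin; toℕ)
open import Data.Fin.Properties using (toℕ-injective; toℕ-fromℕ<; toℕ<n)
open import Data.Fin.Subset using (Subset; ∣_∣; _∈_; _∉_)
open import Data.Product using (∃; _×_; _,_)
open import Data.Sum using (_⊎_; inj₁; inj₂)
open import Data.Empty using (⊥)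
open import Function.Base using (_∘_)
open import Function.Bundles using (_⇔_; Equivalence)
open import Relation.Binary.PropositionalEquality
open import Relation.Nullary using (¬_; yes; no)

≡-mod⇒∣∸ : ∀ m n q .{{_ : NonZero q}} → m % q ≡ n % q → q ∣ n ∸ m
≡-mod⇒∣∸ m n q m≡n = divides (n / q ∸ m / q) (begin
  n ∸ m                                     ≡⟨ cong₂ _∸_ (m≡m%n+[m/n]*n n q) (m≡m%n+[m/n]*n m q) ⟩
  (n % q + n / q * q) ∸ (m % q + m / q * q) ≡⟨ cong (λ k → (n % q + n / q * q) ∸ (k + m / q * q)) m≡n ⟩
  (n % q + n / q * q) ∸ (n % q + m / q * q) ≡⟨ [m+n]∸[m+o]≡n∸o (n % q) _ _ ⟩
  n / q * q ∸ m / q * q                     ≡⟨ *-distribʳ-∸ q (n / q) (m / q) ⟨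
  (n / q ∸ m / q) * q                       ∎)
  where open ≡-Reasoning

∃-adjacent-pair-shifted-out : ∀ {m t q} → 2 ≤ m → 2 + m ≤ q → 2 ≤ t → 2 + t ≤ q →
                              ∃ λ i → suc i < m × m ≤ t + i × t + suc i < q
∃-adjacent-pair-shifted-out {m} {t} {q} 2≤m 2+m≤q 2≤t 2+t≤q = m ∸ t , start , m≤n+m∸n m t , end
  where
  start : 2 + (m ∸ t) ≤ m
  start = ≤-trans (+-monoʳ-≤ 2 (∸-monoʳ-≤ m 2≤t)) (≤-reflexive (m+[n∸m]≡n 2≤m))
  end : t + suc (m ∸ t) < q
  end rewrite +-suc t (m ∸ t) with ≤-total t m
  ... | inj₁ t≤m rewrite m+[n∸m]≡n t≤m = 2+m≤q
  ... | inj₂ m≤t rewrite m≤n⇒m∸n≡0 m≤t | +-identityʳ t = 2+t≤q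

module _ {q : ℕ} .{{_ : NonZero q}} where

  infix 4 _represents_
  _represents_ : Fin q → ℕ → Set
  x represents n = toℕ x ≡ n % q

  ι-represents : ∀ n → ι {q} n represents n
  ι-represents n = toℕ-fromℕ< _

  toℕ-represents : ∀ (x : Fin q) → x represents toℕ x
  toℕ-represents x = sym (m<n⇒m%n≡m (toℕ<n x))

  ⊕-represents : ∀ {x y m n} → x represents m → y represents n → x ⊕ y represents m + n
  ⊕-represents {x} {y} {m} {n} x↦m y↦n = begin
    toℕ (x ⊕ y)          ≡⟨ ι-represents (toℕ x + toℕ y) ⟩
    (toℕ x + toℕ y) % q  ≡⟨ cong₂ (λ u v → (u + v) % q) x↦m y↦n ⟩
    (m % q + n % q) % q  ≡⟨ %-distribˡ-+ m n q ⟨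
    (m + n) % q          ∎
    where open ≡-Reasoning

  ⊗-represents : ∀ {x y m n} → x represents m → y represents n → x ⊗ y represents m * n
  ⊗-represents {x} {y} {m} {n} x↦m y↦n = begin
    toℕ (x ⊗ y)          ≡⟨ ι-represents (toℕ x * toℕ y) ⟩
    (toℕ x * toℕ y) % q  ≡⟨ cong₂ (λ u v → (u * v) % q) x↦m y↦n ⟩
    (m % q * (n % q)) % q ≡⟨ %-distribˡ-* m n q ⟨
    (m * n) % q          ∎
    where open ≡-Reasoning

  represents-≡ : ∀ {x y m n} → x represents m → y represents n → m ≡ n → x ≡ y
  represents-≡ x↦m y↦n refl = toℕ-injective (trans x↦m (sym y↦n))

  ≡⇒represents-≡-mod : ∀ {x y m n} → x represents m → y represents n → x ≡ y → m % q ≡ n % q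
  ≡⇒represents-≡-mod x↦m y↦n refl = trans (sym x↦m) y↦n

  ⊗-assoc : ∀ x y z → (x ⊗ y) ⊗ z ≡ x ⊗ (y ⊗ z)
  ⊗-assoc x y z = represents-≡
    (⊗-represents (⊗-represents (toℕ-represents x) (toℕ-represents y)) (toℕ-represents z))
    (⊗-represents (toℕ-represents x) (⊗-represents (toℕ-represents y) (toℕ-represents z)))
    (*-assoc (toℕ x) (toℕ y) (toℕ z))

  ⊗-comm : ∀ x y → x ⊗ y ≡ y ⊗ x
  ⊗-comm x y = represents-≡
    (⊗-represents (toℕ-represents x) (toℕ-represents y))
    (⊗-represents (toℕ-represents y) (toℕ-represents x))
    (*-comm (toℕ x) (toℕ y))

  x⊗[y⊗z]≡y⊗[x⊗z] : ∀ x y z → x ⊗ (y ⊗ z) ≡ y ⊗ (x ⊗ z)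
  x⊗[y⊗z]≡y⊗[x⊗z] x y z = begin
    x ⊗ (y ⊗ z)  ≡⟨ ⊗-assoc x y z ⟨
    (x ⊗ y) ⊗ z  ≡⟨ cong (_⊗ z) (⊗-comm x y) ⟩
    (y ⊗ x) ⊗ z  ≡⟨ ⊗-assoc y x z ⟩
    y ⊗ (x ⊗ z)  ∎
    where open ≡-Reasoning

  ⊗-identityˡ : ∀ x → 𝟙 ⊗ x ≡ x
  ⊗-identityˡ x = represents-≡ (⊗-represents (ι-represents 1) (toℕ-represents x)) (toℕ-represents x)
    (*-identityˡ (toℕ x))

  ⊗-identityʳ : ∀ x → x ⊗ 𝟙 ≡ x
  ⊗-identityʳ x = trans (⊗-comm x 𝟙) (⊗-identityˡ x)

  ⊗-zeroʳ : ∀ x → x ⊗ 𝟘 ≡ 𝟘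
  ⊗-zeroʳ x = represents-≡ (⊗-represents (toℕ-represents x) (ι-represents 0)) (ι-represents 0)
    (*-zeroʳ (toℕ x))

  toℕ+1≡q⇒x⊗x≡𝟙 : ∀ x → suc (toℕ x) ≡ q → x ⊗ x ≡ 𝟙
  toℕ+1≡q⇒x⊗x≡𝟙 x t+1≡q = toℕ-injective (begin
    toℕ (x ⊗ x)        ≡⟨ ⊗-represents (toℕ-represents x) (toℕ-represents x) ⟩
    t * t % q          ≡⟨ [m+n]%n≡m%n (t * t) q ⟨
    (t * t + q) % q    ≡⟨ cong (λ n → (t * t + n) % q) t+1≡q ⟨
    (t * t + suc t) % q ≡⟨ cong (_% q) (square-identity t) ⟩
    (1 + t * suc t) % q ≡⟨ cong (λ n → (1 + t * n) % q) t+1≡q ⟩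
    (1 + t * q) % q    ≡⟨ [m+kn]%n≡m%n 1 t q ⟩
    1 % q              ≡⟨ ι-represents 1 ⟨
    toℕ 𝟙              ∎)
    where
    open ≡-Reasoning
    t : ℕ
    t = toℕ x
    square-identity : ∀ t → t * t + suc t ≡ 1 + t * suc t
    square-identity = solve-∀

  2≤toℕ∧2+toℕ≤q : ∀ x → x ≢ 𝟘 → x ⊗ x ≢ 𝟙 → 2 ≤ toℕ x × 2 + toℕ x ≤ q
  2≤toℕ∧2+toℕ≤q x x≢𝟘 x⊗x≢𝟙 =
    ≤∧≢⇒< (n≢0⇒n>0 (x≢𝟘 ∘ represents-≡ (toℕ-represents x) (ι-represents 0)))
          (x≢𝟙 ∘ represents-≡ (toℕ-represents x) (ι-represents 1) ∘ sym) ,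
    ≤∧≢⇒< (toℕ<n x) (x⊗x≢𝟙 ∘ toℕ+1≡q⇒x⊗x≡𝟙 x)
    where
    x≢𝟙 : x ≢ 𝟙
    x≢𝟙 refl = x⊗x≢𝟙 (⊗-identityˡ 𝟙)

  ScaleInvariant : Fin q → Subset q → Set
  ScaleInvariant r A = (∀ x → x ∈ A → r ⊗ x ∈ A) × (∀ y → y ∈ A → ∃ λ x → x ∈ A × y ≡ r ⊗ x)

  ⊗-closed⇒^ᶠ-closed : ∀ {r A} → (∀ x → x ∈ A → r ⊗ x ∈ A) → ∀ k x → x ∈ A → r ^ᶠ k ⊗ x ∈ A
  ⊗-closed⇒^ᶠ-closed {r} {A} closed zero x x∈A = subst (_∈ A) (sym (⊗-identityˡ x)) x∈A
  ⊗-closed⇒^ᶠ-closed {r} {A} closed (suc k) x x∈A =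
    subst (_∈ A) (sym (⊗-assoc r (r ^ᶠ k) x)) (closed _ (⊗-closed⇒^ᶠ-closed closed k x x∈A))

  ⊗-^ᶠ-pred-inverse : ∀ {p r} → 0 < p → r ^ᶠ p ≡ 𝟙 → ∀ y → r ⊗ (r ^ᶠ (p ∸ 1) ⊗ y) ≡ y
  ⊗-^ᶠ-pred-inverse {suc p} {r} _ rᵖ≡𝟙 y = begin
    r ⊗ (r ^ᶠ p ⊗ y)  ≡⟨ ⊗-assoc r (r ^ᶠ p) y ⟨
    r ^ᶠ suc p ⊗ y    ≡⟨ cong (_⊗ y) rᵖ≡𝟙 ⟩
    𝟙 ⊗ y             ≡⟨ ⊗-identityˡ y ⟩
    y                 ∎
    where open ≡-Reasoning

  unionOfOrbits⇒⊗-closed : ∀ {p r A} → 0 < p → r ^ᶠ p ≡ 𝟙 → UnionOfOrbits p r A →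
                           ∀ x → x ∈ A → r ⊗ x ∈ A
  unionOfOrbits⇒⊗-closed {p} {r} {A} 0<p rᵖ≡𝟙 orbits x x∈A with orbits x x∈A
  ... | inj₁ refl = subst (_∈ A) (sym (⊗-zeroʳ r)) x∈A
  ... | inj₂ (g , _ , (i , i<p , refl) , coset⊆A) = coset⊆A (r ⊗ (g ⊗ r ^ᶠ i)) next
    where
    r⊗x≡g⊗rⁱ⁺¹ : r ⊗ (g ⊗ r ^ᶠ i) ≡ g ⊗ r ^ᶠ suc i
    r⊗x≡g⊗rⁱ⁺¹ = x⊗[y⊗z]≡y⊗[x⊗z] r g (r ^ᶠ i)
    next : InCoset p r g (r ⊗ (g ⊗ r ^ᶠ i))
    next with suc i <? p
    ... | yes i+1<p = suc i , i+1<p , r⊗x≡g⊗rⁱ⁺¹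
    ... | no i+1≮p = 0 , 0<p , (begin
      r ⊗ (g ⊗ r ^ᶠ i)  ≡⟨ r⊗x≡g⊗rⁱ⁺¹ ⟩
      g ⊗ r ^ᶠ suc i    ≡⟨ cong (λ k → g ⊗ r ^ᶠ k) (≤-antisym i<p (≮⇒≥ i+1≮p)) ⟩
      g ⊗ r ^ᶠ p        ≡⟨ cong (g ⊗_) rᵖ≡𝟙 ⟩
      g ⊗ 𝟙             ∎)
      where open ≡-Reasoning

  unionOfOrbits⇒ScaleInvariant : ∀ {p r A} → 0 < p → r ^ᶠ p ≡ 𝟙 → UnionOfOrbits p r A →
                                 ScaleInvariant r A
  unionOfOrbits⇒ScaleInvariant {p} {r} {A} 0<p rᵖ≡𝟙 orbits = closed , λ y y∈A →
    r ^ᶠ (p ∸ 1) ⊗ y , ⊗-closed⇒^ᶠ-closed closed (p ∸ 1) y y∈A ,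
    sym (⊗-^ᶠ-pred-inverse 0<p rᵖ≡𝟙 y)
    where
    closed : ∀ x → x ∈ A → r ⊗ x ∈ A
    closed = unionOfOrbits⇒⊗-closed 0<p rᵖ≡𝟙 orbits

  progression : Fin q → Fin q → ℕ → Fin q
  progression a d i = a ⊕ ι i ⊗ d

  IsProgression : Fin q → Fin q → ℕ → Subset q → Set
  IsProgression a d m A = ∀ x → (x ∈ A) ⇔ (∃ λ i → i < m × x ≡ progression a d i)

  progression-represents : ∀ a d i → progression a d i represents toℕ a + i * toℕ d
  progression-represents a d i =
    ⊕-represents (toℕ-represents a) (⊗-represents (ι-represents i) (toℕ-represents d))

  progression-injective : Prime q → ∀ a {d} → d ≢ 𝟘 → ∀ {j k} → j < k → k < q →
                          progression a d j ≢ progression a d k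
  progression-injective q-prime a {d} d≢𝟘 {j} {k} j<k k<q APj≡APk
    with euclidsLemma (k ∸ j) (toℕ d) q-prime (subst (q ∣_) difference
           (≡-mod⇒∣∸ _ _ q (≡⇒represents-≡-mod (progression-represents a d j)
                              (progression-represents a d k) APj≡APk)))
    where
    difference : (toℕ a + k * toℕ d) ∸ (toℕ a + j * toℕ d) ≡ (k ∸ j) * toℕ d
    difference = trans ([m+n]∸[m+o]≡n∸o (toℕ a) _ _) (sym (*-distribʳ-∸ (toℕ d) k j))
  ... | inj₁ q∣k∸j = >⇒∤ {{>-nonZero (m<n⇒0<n∸m j<k)}} (≤-<-trans (m∸n≤m k j) k<q) q∣k∸j
  ... | inj₂ q∣d = >⇒∤ {{>-nonZero d>0}} (toℕ<n d) q∣d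
    where
    d>0 : 0 < toℕ d
    d>0 = n≢0⇒n>0 (d≢𝟘 ∘ represents-≡ (toℕ-represents d) (ι-represents 0))

  ⊗-progression-suc : ∀ r a d j → r ⊗ progression a d (suc j) ≡ r ⊗ progression a d j ⊕ r ⊗ d
  ⊗-progression-suc r a d j = represents-≡
    (⊗-represents (toℕ-represents r) (progression-represents a d (suc j)))
    (⊕-represents (⊗-represents (toℕ-represents r) (progression-represents a d j))
                  (⊗-represents (toℕ-represents r) (toℕ-represents d)))
    (distributes (toℕ r) (toℕ a) j (toℕ d))
    where
    distributes : ∀ t a j d → t * (a + suc j * d) ≡ t * (a + j * d) + t * d
    distributes = solve-∀

  progression-⊕-shift : ∀ r a d i → progression a d i ⊕ r ⊗ d ≡ progression a d (toℕ r + i)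
  progression-⊕-shift r a d i = represents-≡
    (⊕-represents (progression-represents a d i) (⊗-represents (toℕ-represents r) (toℕ-represents d)))
    (progression-represents a d (toℕ r + i))
    (shift (toℕ a) i (toℕ d) (toℕ r))
    where
    shift : ∀ a i d t → a + i * d + t * d ≡ a + (t + i) * d
    shift = solve-∀

  ¬ScaleInvariant-progression : Prime q → ∀ {a d m A r} → d ≢ 𝟘 → 2 ≤ m → 2 + m ≤ q →
                                r ≢ 𝟘 → r ⊗ r ≢ 𝟙 → IsProgression a d m A → ¬ ScaleInvariant r A
  ¬ScaleInvariant-progression q-prime {a} {d} {m} {A} {r} d≢𝟘 2≤m 2+m≤q r≢𝟘 r⊗r≢𝟙 A≡AP
                              (r-closed , A⊆rA) = contradiction
    where
    AP : ℕ → Fin q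
    AP = progression a d
    t : ℕ
    t = toℕ r

    term : ∀ {i} → i < m → AP i ∈ A
    term {i} i<m = Equivalence.from (A≡AP (AP i)) (i , i<m , refl)

    AP-injective : ∀ {j k} → j < k → k < q → AP j ≢ AP k
    AP-injective = progression-injective q-prime a d≢𝟘

    shift-∈∨last : ∀ y → y ∈ A → (y ⊕ r ⊗ d ∈ A) ⊎ (y ≡ r ⊗ AP (pred m))
    shift-∈∨last y y∈A with A⊆rA y y∈A
    ... | x , x∈A , refl with Equivalence.to (A≡AP x) x∈A
    ... | j , j<m , refl with suc j <? m
    ... | yes j+1<m = inj₁ (subst (_∈ A) (⊗-progression-suc r a d j) (r-closed _ (term j+1<m)))
    ... | no j+1≮m = inj₂ (cong (λ k → r ⊗ AP (pred k)) (≤-antisym j<m (≮⇒≥ j+1≮m)))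

    shift-∉ : ∀ i → m ≤ t + i → t + i < q → AP i ⊕ r ⊗ d ∉ A
    shift-∉ i m≤t+i t+i<q shift∈A with Equivalence.to (A≡AP _) shift∈A
    ... | k , k<m , shift≡APk =
      AP-injective (<-≤-trans k<m m≤t+i) t+i<q (trans (sym shift≡APk) (progression-⊕-shift r a d i))

    contradiction : ⊥
    contradiction with 2≤toℕ∧2+toℕ≤q r r≢𝟘 r⊗r≢𝟙
    ... | 2≤t , 2+t≤q with ∃-adjacent-pair-shifted-out 2≤m 2+m≤q 2≤t 2+t≤q
    ... | i , i+1<m , m≤t+i , t+i+1<q
      with shift-∈∨last (AP i) (term (<-trans (n<1+n i) i+1<m))
         | shift-∈∨last (AP (suc i)) (term i+1<m)
    ... | inj₁ shift∈A | _ =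
      shift-∉ i m≤t+i (≤-<-trans (+-monoʳ-≤ t (n≤1+n i)) t+i+1<q) shift∈A
    ... | inj₂ _ | inj₁ shift∈A =
      shift-∉ (suc i) (≤-trans m≤t+i (+-monoʳ-≤ t (n≤1+n i))) t+i+1<q shift∈A
    ... | inj₂ APi≡last | inj₂ APi+1≡last =
      AP-injective (n<1+n i) (≤-<-trans (m≤n+m (suc i) t) t+i+1<q) (trans APi≡last (sym APi+1≡last))

lemma5p10 : (p q : ℕ) .{{_ : NonZero q}} → Prime p → Prime q → p ≢ 2 → q ≢ 2
    → p ∣ q ∸ 1 → (r : Fin q) → HasOrder r p
    → (A : Subset q) → UnionOfOrbits p r A
    → 2 ≤ ∣ A ∣ → ∣ A ∣ ≤ q ∸ 2
    → ¬ IsAP A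
lemma5p10 p q p-prime q-prime p≢2 _ _ r (r≢𝟘 , 0<p , rᵖ≡𝟙 , rᵏ≢𝟙) A orbits 2≤m m≤q∸2 (a , d , d≢𝟘 , A≡AP) =
  ¬ScaleInvariant-progression q-prime d≢𝟘 2≤m 2+m≤q r≢𝟘 r⊗r≢𝟙 A≡AP
    (unionOfOrbits⇒ScaleInvariant 0<p rᵖ≡𝟙 orbits)
  where
  2+m≤q : 2 + ∣ A ∣ ≤ q
  2+m≤q = ≤-trans (+-monoʳ-≤ 2 m≤q∸2)
                  (≤-reflexive (m+[n∸m]≡n (nonTrivial⇒n>1 q {{prime⇒nonTrivial q-prime}})))
  2<p : 2 < p
  2<p = ≤∧≢⇒< (nonTrivial⇒n>1 p {{prime⇒nonTrivial p-prime}}) (p≢2 ∘ sym)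
  r⊗r≢𝟙 : r ⊗ r ≢ 𝟙
  r⊗r≢𝟙 r⊗r≡𝟙 = rᵏ≢𝟙 2 (s≤s z≤n) 2<p (trans (cong (r ⊗_) (⊗-identityʳ r)) r⊗r≡𝟙)
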